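{- For all natural numbers $n\geq 0$ and $k$ with $0\leq k\leq n$, and every bijection $b:\{0,\ldots,n\}\to\{0,\ldots,n\}$, the clause $c'_b(k,n)$ is derivable by resolution from $C(n)$.
   Context: Work in a first-order language with a constant $0$, unary function symbols $s$ and $f$, a binary function symbol $\max$, a binary predicate symbol $\leq$, and atoms of the form $f(t)=k$ where $t$ is a term and $k$ is a numeral; here $=$ is an uninterpreted binary predicate (no equality axioms). A clause is a sequent $\Pi \vdash \Delta$ of finite multisets of atoms; its variables are implicitly universally quantified. For $n\ge 0$, $C(n)$ consists of, with variables $\alpha,\beta,\gamma$: (C1) $\vdash \alpha \leq \alpha$; (C2) $\max(\alpha,\beta)\leq\gamma \vdash \alpha\leq\gamma$; (C3) $\max(\alpha,\beta)\leq\gamma \vdash \beta\leq\gamma$; (C4$(k)$) $f(\beta)=k,\ f(\alpha)=k,\ s(\beta)\leq\alpha \vdash$ for each $0\le k\le n$; (C5) $\vdash f(\alpha)=0,\ldots, f(\alpha)=n$. A clause is derivable by resolution from $C(n)$ if it is obtained in finitely many steps from variable-renamed copies of clauses of $C(n)$ by the resolution rule (from $\Pi\vdash P,\Delta$ and $\Pi',P'\vdash\Delta'$ and a substitution $\sigma$ with $P\sigma=P'\sigma$, infer $\Pi\sigma,\Pi'\sigma\vdash\Delta\sigma,\Delta'\sigma$) and contraction (merging identical atoms on one side). Let $x_1,x_2,\ldots$ be variables and, for $k\ge 0$, let $T_k=m(k,x,s(x_{k+1}))=\max(s(x_1),\max(s(x_2),\ldots,\max(s(x_k),s(x_{k+1}))\ldots))$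 (so $T_0=s(x_1)$), where $m(0,x,t)=t$ and $m(k+1,x,t)=m(k,x,\max(s(x_{k+1}),t))$. For $0\le k\le j\le n$ and a bijection $b$ of $\{0,\ldots,n\}$, $c'_b(k,j)$ is the clause $f(x_1)=b(0),\ f(x_2)=b(1),\ \ldots,\ f(x_{k+1})=b(k)\ \vdash\ f(T_k)=b(k+1),\ \ldots,\ f(T_k)=b(j)$ (the succedent is empty when $j=k$). -}

module Defs where

open import Data.Nat using (ℕ; zero; suc; _≤_; _<_; _≤?_; _<?_)
open import Data.Fin using (Fin; toℕ)
open import Data.List using (List; []; _∷_; _++_; map; filter; upTo; allFin)
open import Data.List.Relation.Binary.Permutation.Propositional using (_↭_)
open import Data.Product using (_×_; _,_)
open import Function.Definitions using (Injective)
open import Relation.Binary.PropositionalEquality using (_≡_)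

Var : Set
Var = ℕ

data Term : Set where
  var  : Var → Term
  zro  : Term
  s    : Term → Term
  f    : Term → Term
  mx   : Term → Term → Term

-- Atoms: binary predicates ≤ and (uninterpreted) =.
data Atom : Set where
  _≤'_ : Term → Term → Atom
  _=='_ : Term → Term → Atom

num : ℕ → Term
num zero    = zro
num (suc k) = s (num k)

fEq : Term → ℕ → Atom
fEq t k = f t ==' num k

-- Clauses Π ⊢ Δ; lists taken up to permutation (multisets) via the
-- permutation rule of Derivable below.
Clause : Set
Clause = List Atom × List Atom

Subst : Set
Subst = Var → Term

subT : Subst → Term → Term
subT σ (var x)  = σ x
subT σ zro      = zro
subT σ (s t)    = s (subT σ t)
subT σ (f t)    = f (subT σ t)
subT σ (mx t u) = mx (subT σ t) (subT σ u)

subA : Subst → Atom → Atom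
subA σ (t ≤' u)  = subT σ t ≤' subT σ u
subA σ (t ==' u) = subT σ t ==' subT σ u

subC : Subst → Clause → Clause
subC σ (Π , Δ) = map (subA σ) Π , map (subA σ) Δ

α β γ : Term
α = var 0
β = var 1
γ = var 2

data InC (n : ℕ) : Clause → Set where
  C1 : InC n ([] , (α ≤' α) ∷ [])
  C2 : InC n ((mx α β ≤' γ) ∷ [] , (α ≤' γ) ∷ [])
  C3 : InC n ((mx α β ≤' γ) ∷ [] , (β ≤' γ) ∷ [])
  C4 : (k : ℕ) → k ≤ n →
       InC n (fEq β k ∷ fEq α k ∷ (s β ≤' α) ∷ [] , [])
  C5 : InC n ([] , map (fEq α) (upTo (suc n)))

data Derivable (n : ℕ) : Clause → Set where
  axiom : ∀ {c} → InC n c → (ρ : Var → Var) → Injective _≡_ _≡_ ρ →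
          Derivable n (subC (λ x → var (ρ x)) c)
  perm : ∀ {Π Π' Δ Δ'} → Derivable n (Π , Δ) → Π ↭ Π' → Δ ↭ Δ' →
         Derivable n (Π' , Δ')
  resolve : ∀ {Π Δ Π' Δ' P P'} →
            Derivable n (Π , P ∷ Δ) → Derivable n (P' ∷ Π' , Δ') →
            (σ : Subst) → subA σ P ≡ subA σ P' →
            Derivable n (map (subA σ) Π ++ map (subA σ) Π' ,
                         map (subA σ) Δ ++ map (subA σ) Δ')
  contrL : ∀ {A Π Δ} → Derivable n (A ∷ A ∷ Π , Δ) → Derivable n (A ∷ Π , Δ)
  contrR : ∀ {A Π Δ} → Derivable n (Π , A ∷ A ∷ Δ) → Derivable n (Π , A ∷ Δ)

-- x_i as variable number i (i ≥ 1)
x : ℕ → Term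
x i = var i

m : ℕ → Term → Term
m zero    t = t
m (suc k) t = m k (mx (s (x (suc k))) t)

T : ℕ → Term
T k = m k (s (x (suc k)))

-- c'_b(k,j): f(x_{i+1}) = b(i) for 0 ≤ i ≤ k  ⊢  f(T_k) = b(i) for k < i ≤ j
c' : (n : ℕ) → (Fin (suc n) → Fin (suc n)) → ℕ → ℕ → Clause
c' n b k j =
  map (λ i → fEq (x (suc (toℕ i))) (toℕ (b i)))
      (filter (λ i → toℕ i ≤? k) (allFin (suc n))) ,
  map (λ i → fEq (T k) (toℕ (b i)))
      (filter (λ i → k <? toℕ i) (filter (λ i → toℕ i ≤? j) (allFin (suc n))))

-- Resolving a clause against C4 needs a derivable atom s(t) ≤ c; C1–C3 show that every
-- s(x_{i+1}) with i ≤ k lies below T_k, so f(T_k) = v, f(x_{i+1}) = v ⊢ is derivable for every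
-- value v. Starting from the instance of C5 at T_k, whose succedent lists the values
-- b(0), …, b(n), each literal f(T_k) = b(i) with i ≤ k is resolved away against such a
-- clause, which trades it for the hypothesis f(x_{i+1}) = b(i). To compose resolutions
-- we track clauses all of whose substitution instances are derivable; premises are
-- renamed apart by the even and odd variables.
module Submission where

open import Defs
open import Data.Nat using (ℕ; _≤_; suc; zero; z≤n; s≤s; _+_; _≤?_; _<?_)
open import Data.Nat.Properties using (≤-antisym; +-identityʳ; +-suc; m≤n⇒m<n∨m≡n; ≰⇒>; <⇒≱; ≤-pred; suc-injective)
open import Data.Fin using (Fin; toℕ) renaming (zero to fzero)
import Data.Fin as Fin
open import Data.Fin.Properties using (toℕ<n)
open import Data.List using (List; []; _∷_; _++_; map; filter; upTo; allFin; tabulate; applyUpTo)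
open import Data.List.Properties using (map-++; map-∘; map-cong; map-id; map-tabulate; ++-identityʳ; filter-accept; filter-reject; filter-all)
open import Data.List.Relation.Binary.Permutation.Propositional using (_↭_; ↭-sym; ↭-refl; ↭-reflexive; module PermutationReasoning)
open import Data.List.Relation.Binary.Permutation.Propositional.Properties using (map⁺; shift; ∷↭∷ʳ; ↭-reverse)
open import Data.List.Relation.Binary.BagAndSetEquality using (∼bag⇒↭)
open import Data.List.Membership.Propositional using (_∈_)
open import Data.List.Membership.Propositional.Properties using (∈-allFin; ∈-map⁺)
open import Data.List.Membership.Propositional.Properties.WithK using (unique∧set⇒bag)
open import Data.List.Relation.Unary.Unique.Propositional.Properties using (allFin⁺) renaming (map⁺ to unique-map⁺)
import Data.List.Relation.Unary.All as All
open import Data.Product using (_,_)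
open import Data.Sum using (inj₁; inj₂)
open import Function using (_∘_; id)
open import Function.Bundles using (Bijection; _⤖_; mk⇔)
open import Function.Definitions using (Injective)
open import Relation.Binary.PropositionalEquality
open import Relation.Nullary using (yes; no)

private
  variable
    A : Set
    n l : ℕ
    Π Δ Π' Δ' : List Atom
    P P' : Atom
    σ σ' τ τ' : Subst

_∘ₛ_ : Subst → Subst → Subst
(τ ∘ₛ σ) v = subT τ (σ v)

rename : (Var → Var) → Subst
rename ρ v = var (ρ v)

subT-cong : σ ≗ τ → subT σ ≗ subT τ
subT-cong e (var v)  = e v
subT-cong e zro      = refl
subT-cong e (s t)    = cong s (subT-cong e t)
subT-cong e (f t)    = cong f (subT-cong e t)
subT-cong e (mx t u) = cong₂ mx (subT-cong e t) (subT-cong e u)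

subA-cong : σ ≗ τ → subA σ ≗ subA τ
subA-cong e (t ≤' u)  = cong₂ _≤'_ (subT-cong e t) (subT-cong e u)
subA-cong e (t ==' u) = cong₂ _=='_ (subT-cong e t) (subT-cong e u)

subT-id : subT var ≗ id
subT-id (var v)  = refl
subT-id zro      = refl
subT-id (s t)    = cong s (subT-id t)
subT-id (f t)    = cong f (subT-id t)
subT-id (mx t u) = cong₂ mx (subT-id t) (subT-id u)

subA-id : subA var ≗ id
subA-id (t ≤' u)  = cong₂ _≤'_ (subT-id t) (subT-id u)
subA-id (t ==' u) = cong₂ _=='_ (subT-id t) (subT-id u)

subT-∘ : ∀ σ τ t → subT τ (subT σ t) ≡ subT (τ ∘ₛ σ) t
subT-∘ σ τ (var v)  = refl
subT-∘ σ τ zro      = refl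
subT-∘ σ τ (s t)    = cong s (subT-∘ σ τ t)
subT-∘ σ τ (f t)    = cong f (subT-∘ σ τ t)
subT-∘ σ τ (mx t u) = cong₂ mx (subT-∘ σ τ t) (subT-∘ σ τ u)

subA-∘ : ∀ σ τ a → subA τ (subA σ a) ≡ subA (τ ∘ₛ σ) a
subA-∘ σ τ (t ≤' u)  = cong₂ _≤'_ (subT-∘ σ τ t) (subT-∘ σ τ u)
subA-∘ σ τ (t ==' u) = cong₂ _=='_ (subT-∘ σ τ t) (subT-∘ σ τ u)

subT-num : ∀ σ k → subT σ (num k) ≡ num k
subT-num σ zero    = refl
subT-num σ (suc k) = cong s (subT-num σ k)

subA-fEq : ∀ σ t k → subA σ (fEq t k) ≡ fEq (subT σ t) k
subA-fEq σ t k = cong (f (subT σ t) =='_) (subT-num σ k)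

map-subA-id : map (subA var) ≗ id
map-subA-id as = trans (map-cong subA-id as) (map-id as)

map-subA-∘ : ∀ σ τ as → map (subA τ) (map (subA σ) as) ≡ map (subA (τ ∘ₛ σ)) as
map-subA-∘ σ τ as = trans (sym (map-∘ as)) (map-cong (subA-∘ σ τ) as)

subC-id : subC var ≗ id
subC-id (Π , Δ) = cong₂ _,_ (map-subA-id Π) (map-subA-id Δ)

double : ℕ → ℕ
double zero    = zero
double (suc v) = suc (suc (double v))

double-injective : Injective _≡_ _≡_ double
double-injective {zero}  {zero}  _ = refl
double-injective {suc u} {suc v} e = cong suc (double-injective (suc-injective (suc-injective e)))

odd : ℕ → ℕ
odd = suc ∘ double

odd-injective : Injective _≡_ _≡_ odd
odd-injective = double-injective ∘ suc-injective

interleave : Subst → Subst → Subst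
interleave σ τ zero           = σ zero
interleave σ τ (suc zero)     = τ zero
interleave σ τ (suc (suc v)) = interleave (σ ∘ suc) (τ ∘ suc) v

interleave-double : ∀ σ τ → interleave σ τ ∘ₛ rename double ≗ σ
interleave-double σ τ zero    = refl
interleave-double σ τ (suc v) = interleave-double (σ ∘ suc) (τ ∘ suc) v

interleave-odd : ∀ σ τ → interleave σ τ ∘ₛ rename odd ≗ τ
interleave-odd σ τ zero    = refl
interleave-odd σ τ (suc v) = interleave-odd (σ ∘ suc) (τ ∘ suc) v

resolvent : Subst → Subst → Clause → Clause → Clause
resolvent σ τ (Π , Δ) (Π' , Δ') =
  map (subA σ) Π ++ map (subA τ) Π' , map (subA σ) Δ ++ map (subA τ) Δ'

resolvent-cong : σ ≗ σ' → τ ≗ τ' → ∀ c d → resolvent σ τ c d ≡ resolvent σ' τ' c d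
resolvent-cong e e' (Π , Δ) (Π' , Δ') =
  cong₂ _,_ (cong₂ _++_ (map-cong (subA-cong e) Π) (map-cong (subA-cong e') Π'))
            (cong₂ _++_ (map-cong (subA-cong e) Δ) (map-cong (subA-cong e') Δ'))

resolvent-subC : ∀ σ τ σ₀ τ₀ c d →
  resolvent σ τ (subC σ₀ c) (subC τ₀ d) ≡ resolvent (σ ∘ₛ σ₀) (τ ∘ₛ τ₀) c d
resolvent-subC σ τ σ₀ τ₀ (Π , Δ) (Π' , Δ') =
  cong₂ _,_ (cong₂ _++_ (map-subA-∘ σ₀ σ Π) (map-subA-∘ τ₀ τ Π'))
            (cong₂ _++_ (map-subA-∘ σ₀ σ Δ) (map-subA-∘ τ₀ τ Δ'))

subC-resolvent : ∀ ρ σ τ c d → subC ρ (resolvent σ τ c d) ≡ resolvent ρ ρ (subC σ c) (subC τ d)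
subC-resolvent ρ σ τ (Π , Δ) (Π' , Δ') =
  cong₂ _,_ (map-++ (subA ρ) (map (subA σ) Π) (map (subA τ) Π'))
            (map-++ (subA ρ) (map (subA σ) Δ) (map (subA τ) Δ'))

resolvent-id : ∀ Π Δ Π' Δ' → resolvent var var (Π , Δ) (Π' , Δ') ≡ (Π ++ Π' , Δ ++ Δ')
resolvent-id Π Δ Π' Δ' =
  cong₂ _,_ (cong₂ _++_ (map-subA-id Π) (map-subA-id Π'))
            (cong₂ _++_ (map-subA-id Δ) (map-subA-id Δ'))

record Renamable (n : ℕ) (c : Clause) : Set where
  constructor renamable
  field derive-renamed : ∀ ρ → Injective _≡_ _≡_ ρ → Derivable n (subC (rename ρ) c)
open Renamable

record Schematic (n : ℕ) (c : Clause) : Set where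
  constructor schematic
  field derive-instance : ∀ σ → Derivable n (subC σ c)
open Schematic

axiom-renamable : ∀ {c} → InC n c → Renamable n c
axiom-renamable c∈C = renamable (axiom c∈C)

schematic⇒renamable : ∀ {c} → Schematic n c → Renamable n c
schematic⇒renamable S = renamable (λ ρ _ → derive-instance S (rename ρ))

schematic⇒derivable : ∀ {c} → Schematic n c → Derivable n c
schematic⇒derivable {c = c} S = subst (Derivable _) (subC-id c) (derive-instance S var)

renamable-↭ : Π ↭ Π' → Δ ↭ Δ' → Renamable n (Π , Δ) → Renamable n (Π' , Δ')
renamable-↭ p q R = renamable (λ ρ ρ-inj → perm (derive-renamed R ρ ρ-inj) (map⁺ _ p) (map⁺ _ q))

schematic-↭ : Π ↭ Π' → Δ ↭ Δ' → Schematic n (Π , Δ) → Schematic n (Π' , Δ')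
schematic-↭ p q S = schematic (λ σ → perm (derive-instance S σ) (map⁺ _ p) (map⁺ _ q))

resolve-apart : Renamable n (Π , P ∷ Δ) → Renamable n (P' ∷ Π' , Δ') →
  ∀ σ τ → subA σ P ≡ subA τ P' → Derivable n (resolvent σ τ (Π , Δ) (Π' , Δ'))
resolve-apart {Π = Π} {P = P} {Δ = Δ} {P' = P'} {Π' = Π'} {Δ' = Δ'} R R' σ τ eq =
  subst (Derivable _) renamed-apart
    (resolve (derive-renamed R double double-injective) (derive-renamed R' odd odd-injective)
             (interleave σ τ) eq-apart)
  where
  eq-apart : subA (interleave σ τ) (subA (rename double) P)
           ≡ subA (interleave σ τ) (subA (rename odd) P')
  eq-apart = begin
    subA (interleave σ τ) (subA (rename double) P) ≡⟨ subA-∘ _ _ P ⟩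
    subA (interleave σ τ ∘ₛ rename double) P        ≡⟨ subA-cong (interleave-double σ τ) P ⟩
    subA σ P                                        ≡⟨ eq ⟩
    subA τ P'                                       ≡⟨ subA-cong (interleave-odd σ τ) P' ⟨
    subA (interleave σ τ ∘ₛ rename odd) P'          ≡⟨ subA-∘ _ _ P' ⟨
    subA (interleave σ τ) (subA (rename odd) P')    ∎
    where open ≡-Reasoning
  renamed-apart : resolvent (interleave σ τ) (interleave σ τ)
                    (subC (rename double) (Π , Δ)) (subC (rename odd) (Π' , Δ'))
                ≡ resolvent σ τ (Π , Δ) (Π' , Δ')
  renamed-apart = trans (resolvent-subC _ _ _ _ (Π , Δ) (Π' , Δ'))
                        (resolvent-cong (interleave-double σ τ) (interleave-odd σ τ) (Π , Δ) (Π' , Δ'))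

resolve-schematic : Renamable n (Π , P ∷ Δ) → Renamable n (P' ∷ Π' , Δ') →
  ∀ σ τ → subA σ P ≡ subA τ P' → Schematic n (resolvent σ τ (Π , Δ) (Π' , Δ'))
resolve-schematic {Π = Π} {P = P} {Δ = Δ} {P' = P'} {Π' = Π'} {Δ' = Δ'} R R' σ τ eq =
  schematic λ ρ → subst (Derivable _) (sym (instantiated ρ))
    (resolve-apart R R' (ρ ∘ₛ σ) (ρ ∘ₛ τ)
      (trans (sym (subA-∘ σ ρ P)) (trans (cong (subA ρ) eq) (subA-∘ τ ρ P'))))
  where
  instantiated : ∀ ρ → subC ρ (resolvent σ τ (Π , Δ) (Π' , Δ'))
                     ≡ resolvent (ρ ∘ₛ σ) (ρ ∘ₛ τ) (Π , Δ) (Π' , Δ')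
  instantiated ρ = trans (subC-resolvent ρ σ τ (Π , Δ) (Π' , Δ'))
                         (resolvent-subC ρ ρ σ τ (Π , Δ) (Π' , Δ'))

resolve-schematic-same : Schematic n (Π , P ∷ Δ) → Schematic n (P ∷ Π' , Δ') →
  Schematic n (Π ++ Π' , Δ ++ Δ')
resolve-schematic-same {Π = Π} {Δ = Δ} {Π' = Π'} {Δ' = Δ'} S S' =
  subst (Schematic _) (resolvent-id Π Δ Π' Δ')
    (resolve-schematic (schematic⇒renamable S) (schematic⇒renamable S') var var refl)

-- Instantiates α, β, γ, … in turn; later variables are shifted, which is harmless since
-- the clauses of C(n) only mention α, β, γ.
assign : List Term → Subst
assign []       = var
assign (t ∷ ts) zero    = t
assign (t ∷ ts) (suc v) = assign ts v

≤-maxˡ : ∀ a b → Schematic n ([] , a ≤' mx a b ∷ [])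
≤-maxˡ a b = resolve-schematic (axiom-renamable C1) (axiom-renamable C2)
  (assign (mx a b ∷ [])) (assign (a ∷ b ∷ mx a b ∷ [])) refl

≤-maxʳ : ∀ a b → Schematic n ([] , b ≤' mx a b ∷ [])
≤-maxʳ a b = resolve-schematic (axiom-renamable C1) (axiom-renamable C3)
  (assign (mx a b ∷ [])) (assign (a ∷ b ∷ mx a b ∷ [])) refl

max-≤ˡ : ∀ a b c → Schematic n ([] , mx a b ≤' c ∷ []) → Schematic n ([] , a ≤' c ∷ [])
max-≤ˡ a b c S = resolve-schematic (schematic⇒renamable S) (axiom-renamable C2)
  var (assign (a ∷ b ∷ c ∷ [])) (subA-id _)

max-≤ʳ : ∀ a b c → Schematic n ([] , mx a b ≤' c ∷ []) → Schematic n ([] , b ≤' c ∷ [])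
max-≤ʳ a b c S = resolve-schematic (schematic⇒renamable S) (axiom-renamable C3)
  var (assign (a ∷ b ∷ c ∷ [])) (subA-id _)

maxChain : ℕ → ℕ → Term
maxChain j zero    = s (x j)
maxChain j (suc d) = mx (s (x j)) (maxChain (suc j) d)

m-maxChain : ∀ k d → m k (maxChain (suc k) d) ≡ maxChain 1 (k + d)
m-maxChain zero    d = refl
m-maxChain (suc k) d = trans (m-maxChain k (suc d)) (cong (maxChain 1) (+-suc k d))

T≡maxChain : ∀ k → T k ≡ maxChain 1 k
T≡maxChain k = trans (m-maxChain k 0) (cong (maxChain 1) (+-identityʳ k))

maxChain-≤ : ∀ {j i} d c → Schematic n ([] , maxChain j d ≤' c ∷ []) →
  j ≤ i → i ≤ j + d → Schematic n ([] , s (x i) ≤' c ∷ [])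
maxChain-≤ {j = j} {i} zero c S j≤i i≤j+0
  with refl ← ≤-antisym j≤i (subst (i ≤_) (+-identityʳ j) i≤j+0) = S
maxChain-≤ {j = j} {i} (suc d) c S j≤i i≤j+d with m≤n⇒m<n∨m≡n j≤i
... | inj₂ refl = max-≤ˡ _ _ c S
... | inj₁ j<i  = maxChain-≤ d c (max-≤ʳ _ _ c S) j<i (subst (i ≤_) (+-suc j d) i≤j+d)

≤-maxChain : ∀ {j i} d → j ≤ i → i ≤ j + suc d →
  Schematic n ([] , s (x i) ≤' maxChain j (suc d) ∷ [])
≤-maxChain {j = j} {i} d j≤i i≤j+d with m≤n⇒m<n∨m≡n j≤i
... | inj₂ refl = ≤-maxˡ _ _
... | inj₁ j<i  = maxChain-≤ d _ (≤-maxʳ _ _) j<i (subst (i ≤_) (+-suc j d) i≤j+d)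

C4-cut : ∀ {t c v} → Renamable n ([] , P ∷ []) → ∀ σ → subA σ P ≡ (s t ≤' c) → v ≤ n →
  Schematic n (fEq c v ∷ fEq t v ∷ [] , [])
C4-cut {t = t} {c = c} {v = v} R σ eq v≤n =
  subst (Schematic _) (cong (_, []) (cong₂ _∷_ (subA-fEq αβ≔ct α v) (cong (_∷ []) (subA-fEq αβ≔ct β v))))
    (resolve-schematic R C4-reordered σ αβ≔ct eq)
  where
  αβ≔ct : Subst
  αβ≔ct = assign (c ∷ t ∷ [])
  C4-reordered : Renamable _ ((s β ≤' α) ∷ fEq α v ∷ fEq β v ∷ [] , [])
  C4-reordered = renamable-↭ (↭-sym (↭-reverse _)) ↭-refl (axiom-renamable (C4 v v≤n))

T-clash : ∀ {i v} k → i ≤ k → v ≤ n → Schematic n (fEq (T k) v ∷ fEq (x (suc i)) v ∷ [] , [])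
T-clash zero    z≤n v≤n = C4-cut (axiom-renamable C1) (assign (s (x 1) ∷ [])) refl v≤n
T-clash {i = i} {v = v} (suc k) i≤k v≤n =
  subst (λ t → Schematic _ (fEq t v ∷ fEq (x (suc i)) v ∷ [] , [])) (sym (T≡maxChain (suc k)))
    (C4-cut (schematic⇒renamable (≤-maxChain k (s≤s z≤n) (s≤s i≤k))) var (subA-id _) v≤n)

tabulate-toℕ : ∀ l (g : ℕ → A) → tabulate {n = l} (g ∘ toℕ) ≡ applyUpTo g l
tabulate-toℕ zero    g = refl
tabulate-toℕ (suc l) g = cong (g 0 ∷_) (tabulate-toℕ l (g ∘ suc))

map-toℕ-allFin : ∀ l → map toℕ (allFin l) ≡ upTo l
map-toℕ-allFin l = trans (map-tabulate id toℕ) (tabulate-toℕ l id)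

map-bijection-allFin : (π : Fin l ⤖ Fin l) → map (Bijection.to π) (allFin l) ↭ allFin l
map-bijection-allFin {l = l} π =
  ∼bag⇒↭ (unique∧set⇒bag (unique-map⁺ (Bijection.injective π) (allFin⁺ l)) (allFin⁺ l)
    (mk⇔ (λ _ → ∈-allFin _) in-image))
  where
  in-image : ∀ {z} → z ∈ allFin l → z ∈ map (Bijection.to π) (allFin l)
  in-image {z} _ with (y , to-y≡z) ← Bijection.surjective π z =
    subst (_∈ map (Bijection.to π) (allFin l)) (to-y≡z refl) (∈-map⁺ _ (∈-allFin y))

module Elimination (n k : ℕ) (π : Fin (suc n) ⤖ Fin (suc n)) where

  b : Fin (suc n) → Fin (suc n)
  b = Bijection.to π

  value : Fin (suc n) → ℕ
  value i = toℕ (b i)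

  value≤n : ∀ i → value i ≤ n
  value≤n i = ≤-pred (toℕ<n (b i))

  hyp concl : Fin (suc n) → Atom
  hyp i   = fEq (x (suc (toℕ i))) (value i)
  concl i = fEq (T k) (value i)

  eliminate : ∀ rs → Schematic n (Π , map concl rs ++ Δ) →
    Schematic n (map hyp (filter (λ i → toℕ i ≤? k) rs) ++ Π ,
                 map concl (filter (λ i → k <? toℕ i) rs) ++ Δ)
  eliminate [] S = S
  eliminate {Π = Π} {Δ = Δ} (r ∷ rs) S with toℕ r ≤? k
  ... | yes r≤k
    rewrite filter-accept (λ i → toℕ i ≤? k) {xs = rs} r≤k
          | filter-reject (λ i → k <? toℕ i) {xs = rs} (λ k<r → <⇒≱ k<r r≤k) =
    schematic-↭ (shift (hyp r) _ Π) ↭-refl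
      (eliminate rs (schematic-↭ (↭-sym (∷↭∷ʳ (hyp r) Π)) (↭-reflexive (++-identityʳ _))
        (resolve-schematic-same S (T-clash k r≤k (value≤n r)))))
  ... | no r≰k
    rewrite filter-reject (λ i → toℕ i ≤? k) {xs = rs} r≰k
          | filter-accept (λ i → k <? toℕ i) {xs = rs} (≰⇒> r≰k) =
    schematic-↭ ↭-refl (shift (concl r) _ Δ)
      (eliminate rs (schematic-↭ ↭-refl (↭-sym (shift (concl r) (map concl rs) Δ)) S))

  C5-by-b : Renamable n ([] , map (fEq α ∘ value) (allFin (suc n)))
  C5-by-b = renamable-↭ ↭-refl upTo↭values (axiom-renamable C5)
    where
    upTo↭values : map (fEq α) (upTo (suc n)) ↭ map (fEq α ∘ value) (allFin (suc n))
    upTo↭values = begin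
      map (fEq α) (upTo (suc n))                 ≡⟨ cong (map (fEq α)) (map-toℕ-allFin (suc n)) ⟨
      map (fEq α) (map toℕ (allFin (suc n)))     ≡⟨ map-∘ (allFin (suc n)) ⟨
      map (fEq α ∘ toℕ) (allFin (suc n))         ↭⟨ map⁺ (fEq α ∘ toℕ) (map-bijection-allFin π) ⟨
      map (fEq α ∘ toℕ) (map b (allFin (suc n))) ≡⟨ map-∘ (allFin (suc n)) ⟨
      map (fEq α ∘ value) (allFin (suc n))       ∎
      where open PermutationReasoning

  rest : List (Fin (suc n))
  rest = tabulate Fin.suc

  start : Schematic n (hyp fzero ∷ [] , map concl rest ++ [])
  start = subst (Schematic n) resolved
    (resolve-schematic C5-by-b (schematic⇒renamable (T-clash k z≤n (value≤n fzero)))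
      (assign (T k ∷ [])) var (trans (subA-fEq _ α (value fzero)) (sym (subA-id (concl fzero)))))
    where
    resolved : resolvent (assign (T k ∷ [])) var ([] , map (fEq α ∘ value) rest) (hyp fzero ∷ [] , [])
             ≡ (hyp fzero ∷ [] , map concl rest ++ [])
    resolved = cong₂ _,_ (cong (_∷ []) (subA-id _))
      (cong (_++ []) (trans (sym (map-∘ rest)) (map-cong (λ i → subA-fEq _ α (value i)) rest)))

  -- allFin (suc n) unfolds to fzero ∷ rest, and both filters decide fzero by computation.
  derivable : Derivable n (c' n b k n)
  derivable = schematic⇒derivable
    (schematic-↭ (↭-sym (∷↭∷ʳ _ _)) (↭-reflexive succedent) (eliminate rest start))
    where
    succedent : map concl (filter (λ i → k <? toℕ i) rest) ++ []
              ≡ map concl (filter (λ i → k <? toℕ i) (filter (λ i → toℕ i ≤? n) (allFin (suc n))))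
    succedent = trans (++-identityʳ _)
      (cong (map concl ∘ filter (λ i → k <? toℕ i))
        (sym (filter-all (λ i → toℕ i ≤? n) {xs = allFin (suc n)} (All.tabulate (λ {i} _ → ≤-pred (toℕ<n i))))))

lemma5 : (n k : ℕ) → k ≤ n → (b : Fin (suc n) ⤖ Fin (suc n)) →
    Derivable n (c' n (Bijection.to b) k n)
lemma5 n k _ π = Elimination.derivable n k π
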